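{- Let $r\ge 6$ and let $G$ be a graph with maximum degree at most $r$ and clique number at most $r$. Call a set $C\subseteq V(G)$ a configuration if $|C|=r+1$ and the induced subgraph $G[C]$ is the complete graph on $C$ minus exactly two edges. Then any two distinct configurations in $G$ are disjoint.
   Context: All graphs are finite and simple. -}

module Defs where

open import Data.Nat using (ℕ; _≤_; _<_)
open import Data.Bool using (Bool; true; false; T; not; _∧_)
open import Data.Fin using (Fin; toℕ)
open import Data.Fin.Subset using (Subset; _∈_; ∣_∣; _∩_; Empty)
open import Data.Vec using (tabulate)
open import Data.List using (List; filter; length; allFin; concatMap; map)
open import Relation.Binary.PropositionalEquality using (_≡_)
open import Relation.Nullary using (¬_; Dec; yes; no)
open import Data.Product using (_×_; _,_)
open import Data.Nat.Properties using (_<?_)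
open import Relation.Nullary.Decidable using (⌊_⌋)

record Graph (n : ℕ) : Set where
  field
    adj     : Fin n → Fin n → Bool
    symm    : ∀ u v → adj u v ≡ adj v u
    irrefl  : ∀ v → adj v v ≡ false
open Graph public

Adj : ∀ {n} → Graph n → Fin n → Fin n → Set
Adj G u v = T (adj G u v)

N : ∀ {n} → Graph n → Fin n → Subset n
N G v = tabulate (λ u → adj G v u)

deg : ∀ {n} → Graph n → Fin n → ℕ
deg G v = ∣ N G v ∣

MaxDegreeAtMost : ∀ {n} → Graph n → ℕ → Set
MaxDegreeAtMost G r = ∀ v → deg G v ≤ r

IsClique : ∀ {n} → Graph n → Subset n → Set
IsClique G K = ∀ u v → u ∈ K → v ∈ K → ¬ (u ≡ v) → Adj G u v

CliqueNumberAtMost : ∀ {n} → Graph n → ℕ → Set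
CliqueNumberAtMost G r = ∀ K → IsClique G K → ∣ K ∣ ≤ r

mem : ∀ {n} → Fin n → Subset n → Bool
mem i C = Data.Vec.lookup C i
  where import Data.Vec

-- Unordered pairs {u,v} (u ≠ v) of vertices of C that are NOT adjacent in G,
-- listed once each as (u , v) with toℕ u < toℕ v.
-- These are exactly the edges of the complete graph on C missing from G[C].
missingPairs : ∀ {n} → Graph n → Subset n → List (Fin n × Fin n)
missingPairs {n} G C =
  filter (λ p → decT (test p))
    (concatMap (λ u → map (λ v → (u , v)) (allFin n)) (allFin n))
  where
  test : Fin n × Fin n → Bool
  test (u , v) = ⌊ toℕ u <? toℕ v ⌋ ∧ mem u C ∧ mem v C ∧ not (adj G u v)
  decT : (b : Bool) → Dec (T b)
  decT true  = yes _
  decT false = no (λ ())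

missingEdges : ∀ {n} → Graph n → Subset n → ℕ
missingEdges G C = length (missingPairs G C)

IsConfiguration : ∀ {n} → Graph n → ℕ → Subset n → Set
IsConfiguration G r C = ∣ C ∣ ≡ Data.Nat.suc r × missingEdges G C ≡ 2
  where import Data.Nat

Disjoint : ∀ {n} → Subset n → Subset n → Set
Disjoint C D = Empty (C ∩ D)

module Submission where

-- Write S = C ∩ D and T = D ─ C, and let m_C(u) count the non-neighbours of u inside C.
-- A vertex u ∈ C has r − m_C(u) neighbours in C, so by the degree bound at most m_C(u)
-- neighbours outside C; summed over S this bounds the number of S–T edges by Σ_S m_C.
-- Conversely a vertex y ∈ T is non-adjacent to at most m_D(y) vertices of S ⊆ D, so
-- |T|·|S| ≤ e(S,T) + Σ_T m_D. As Σ_C m_C = 2·2, this gives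
-- |T|·|S| + Σ_{C─D} m_C ≤ 4 + Σ_T m_D, and the same with C and D exchanged; adding the two,
-- |T|·|S| ≤ 4. But |S| + |T| = r + 1 with S and T nonempty, so |T|·|S| ≥ r ≥ 6.

open import Defs
open import Data.Nat using (ℕ; zero; suc; _+_; _*_; _≤_; _<_; _>_; z≤n; s≤s; _≤?_; _<?_)
open import Data.Nat.Properties
  using ( +-*-semiring; +-commutativeSemigroup; *-commutativeSemigroup; module ≤-Reasoning
        ; +-comm; +-identityʳ; *-identityʳ; *-distribˡ-+; +-cancelˡ-≡; +-cancelˡ-≤; +-cancelʳ-≤
        ; +-mono-≤; +-monoˡ-≤; +-monoʳ-≤; +-mono-<; m≤m+n; m≤n+m; m≤m*n
        ; ≤-reflexive; ≤-trans; ≤-pred; <⇒≱; ≰⇒>; <-cmp; n≢0⇒n>0 )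
open import Data.Bool using (Bool; true; false; T; not; _∧_)
open import Data.Bool.Properties using (∧-zeroʳ; ∧-identityʳ; not-injective)
open import Data.Fin using (Fin; toℕ; _≟_) renaming (zero to fzero; suc to fsuc)
open import Data.Fin.Properties using (toℕ-injective)
open import Data.Fin.Subset using (Subset; _∩_; _─_; ∣_∣; _⊆_; Nonempty; inside; outside)
open import Data.Fin.Subset.Properties using (⊆-antisym; ∩-comm; x∈p⇒∣p-x∣<∣p∣)
open import Data.List as List using (List; length; filter; concatMap; _++_)
open import Data.List.Properties using (filter-++; length-++; map-tabulate)
open import Data.Product using (_×_; _,_; proj₁)
open import Data.Unit using (tt)
open import Data.Vec using ([]; _∷_; here; there)
open import Data.Vec.Properties using (lookup-zipWith; lookup∘tabulate)
open import Function using (_∘_; id)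
open import Algebra.Properties.Semiring.Sum +-*-semiring
  using (sum; sum-cong-≗; ∑-distrib-+; ∑-comm; *-distribˡ-sum; *-distribʳ-sum)
import Algebra.Properties.CommutativeSemigroup +-commutativeSemigroup as +-CS
import Algebra.Properties.CommutativeSemigroup *-commutativeSemigroup as *-CS
open import Relation.Binary using (tri<; tri≈; tri>)
open import Relation.Binary.PropositionalEquality
  using (_≡_; _≢_; refl; sym; trans; cong; cong₂; subst; subst₂; module ≡-Reasoning)
open import Relation.Nullary using (¬_; Dec; yes; no; does; contradiction)
open import Relation.Nullary.Decidable using (⌊_⌋; from-no)
open import Relation.Unary using (Decidable)

private
  variable
    n : ℕ
    f g : Fin n → ℕ

m+n≤1+m*n : ∀ {m n} → m > 0 → n > 0 → m + n ≤ suc (m * n)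
m+n≤1+m*n {suc m} {suc n} _ _ = s≤s (begin
  m + suc n         ≡⟨ +-comm m (suc n) ⟩
  suc n + m         ≤⟨ +-monoʳ-≤ (suc n) (m≤m*n m (suc n)) ⟩
  suc n + m * suc n ∎)
  where open ≤-Reasoning

m+m≤n+n⇒m≤n : ∀ {m n} → m + m ≤ n + n → m ≤ n
m+m≤n+n⇒m≤n {m} {n} m+m≤n+n with m ≤? n
... | yes m≤n = m≤n
... | no  m≰n = contradiction m+m≤n+n (<⇒≱ (+-mono-< (≰⇒> m≰n) (≰⇒> m≰n)))

≤-from-crossed : ∀ {x a b c} → x + a ≤ c + b → x + b ≤ c + a → x ≤ c
≤-from-crossed {x} {a} {b} {c} h₁ h₂ = m+m≤n+n⇒m≤n (+-cancelʳ-≤ (a + b) (x + x) (c + c) (begin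
  x + x + (a + b) ≡⟨ +-CS.interchange x x a b ⟩
  x + a + (x + b) ≤⟨ +-mono-≤ h₁ h₂ ⟩
  c + b + (c + a) ≡⟨ +-CS.interchange c b c a ⟩
  c + c + (b + a) ≡⟨ cong (c + c +_) (+-comm b a) ⟩
  c + c + (a + b) ∎))
  where open ≤-Reasoning

χ : Bool → ℕ
χ true  = 1
χ false = 0

1≤χa+χb : ∀ a {b} → (a ≡ false → b ≡ true) → 1 ≤ χ a + χ b
1≤χa+χb true  _ = s≤s z≤n
1≤χa+χb false b≡true = subst (λ b → 1 ≤ χ b) (sym (b≡true refl)) (s≤s z≤n)

∧-true⇒ : ∀ {a b} → a ∧ b ≡ true → a ≡ true × b ≡ true
∧-true⇒ {true} {true} refl = refl , refl

∑-mono-≤ : (∀ i → f i ≤ g i) → sum f ≤ sum g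
∑-mono-≤ {zero}  f≤g = z≤n
∑-mono-≤ {suc n} f≤g = +-mono-≤ (f≤g fzero) (∑-mono-≤ (λ i → f≤g (fsuc i)))

-- Stated with does rather than ⌊_⌋, which does not compute through the map′ in fsuc v ≟ fsuc u.
∑-δ : (u : Fin n) → sum (λ v → χ (does (v ≟ u))) ≡ 1
∑-δ {suc n} fzero = cong suc (∑-zero n)
  where
  ∑-zero : ∀ n → sum {n} (λ v → χ (does (fsuc v ≟ fzero))) ≡ 0
  ∑-zero zero    = refl
  ∑-zero (suc n) = ∑-zero n
∑-δ (fsuc u) = ∑-δ u

∑∈ : Subset n → (Fin n → ℕ) → ℕ
∑∈ p f = sum (λ i → χ (mem i p) * f i)

syntax ∑∈ p (λ i → e) = ∑[ i ∈ p ] e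

mem-∩ : (i : Fin n) (p q : Subset n) → mem i (p ∩ q) ≡ mem i p ∧ mem i q
mem-∩ i p q = lookup-zipWith _∧_ i p q

mem-─ : (i : Fin n) (p q : Subset n) → mem i (p ─ q) ≡ mem i p ∧ not (mem i q)
mem-─ fzero    (x ∷ p) (inside  ∷ q) = sym (∧-zeroʳ x)
mem-─ fzero    (x ∷ p) (outside ∷ q) = sym (∧-identityʳ x)
mem-─ (fsuc i) (x ∷ p) (y ∷ q)       = mem-─ i p q

∈∩⇒ : (i : Fin n) (p q : Subset n) → mem i (p ∩ q) ≡ true → mem i p ≡ true × mem i q ≡ true
∈∩⇒ i p q i∈p∩q = ∧-true⇒ (trans (sym (mem-∩ i p q)) i∈p∩q)

∈─⇒ : (i : Fin n) (p q : Subset n) → mem i (p ─ q) ≡ true → mem i p ≡ true × mem i q ≡ false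
∈─⇒ i p q i∈p─q with ∧-true⇒ (trans (sym (mem-─ i p q)) i∈p─q)
... | i∈p , i∉q = i∈p , not-injective i∉q

mem-separates : {i j : Fin n} (p : Subset n) → mem i p ≡ false → mem j p ≡ true → i ≢ j
mem-separates p i∉p j∈p refl with trans (sym i∉p) j∈p
... | ()

∣p∣≡∑χ : (p : Subset n) → ∣ p ∣ ≡ sum (λ i → χ (mem i p))
∣p∣≡∑χ []            = refl
∣p∣≡∑χ (outside ∷ p) = ∣p∣≡∑χ p
∣p∣≡∑χ (inside ∷ p)  = cong suc (∣p∣≡∑χ p)

∑∈-const : (p : Subset n) (c : ℕ) → ∑[ i ∈ p ] c ≡ ∣ p ∣ * c
∑∈-const p c = trans (sym (*-distribʳ-sum c (λ i → χ (mem i p)))) (cong (_* c) (sym (∣p∣≡∑χ p)))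

∣p∣≡∑∈1 : (p : Subset n) → ∣ p ∣ ≡ ∑[ i ∈ p ] 1
∣p∣≡∑∈1 p = trans (sym (*-identityʳ ∣ p ∣)) (sym (∑∈-const p 1))

∑∈-mono-≤ : (p : Subset n) → (∀ i → mem i p ≡ true → f i ≤ g i) → ∑[ i ∈ p ] f i ≤ ∑[ i ∈ p ] g i
∑∈-mono-≤ {f = f} {g = g} p f≤g = ∑-mono-≤ pointwise
  where
  pointwise : ∀ i → χ (mem i p) * f i ≤ χ (mem i p) * g i
  pointwise i with mem i p in i∈p
  ... | false = z≤n
  ... | true  = +-monoˡ-≤ 0 (f≤g i i∈p)

∑∈-distrib-+ : (p : Subset n) (f g : Fin n → ℕ) → ∑[ i ∈ p ] (f i + g i) ≡ ∑[ i ∈ p ] f i + ∑[ i ∈ p ] g i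
∑∈-distrib-+ p f g = trans (sum-cong-≗ (λ i → *-distribˡ-+ (χ (mem i p)) (f i) (g i)))
                           (∑-distrib-+ (λ i → χ (mem i p) * f i) (λ i → χ (mem i p) * g i))

∑∈≤∑ : (p : Subset n) (f : Fin n → ℕ) → ∑[ i ∈ p ] f i ≤ sum f
∑∈≤∑ p f = ∑-mono-≤ λ i → χ*≤ (mem i p) (f i)
  where
  χ*≤ : ∀ b x → χ b * x ≤ x
  χ*≤ false x = z≤n
  χ*≤ true  x = ≤-reflexive (+-identityʳ x)

∑∈-comm : (p q : Subset n) (h : Fin n → Fin n → ℕ) →
          ∑[ u ∈ p ] ∑[ v ∈ q ] h u v ≡ ∑[ v ∈ q ] ∑[ u ∈ p ] h u v
∑∈-comm p q h = begin
  sum (λ u → χ (mem u p) * sum (λ v → χ (mem v q) * h u v))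
    ≡⟨ sum-cong-≗ (λ u → *-distribˡ-sum (χ (mem u p)) (λ v → χ (mem v q) * h u v)) ⟩
  sum (λ u → sum (λ v → χ (mem u p) * (χ (mem v q) * h u v)))
    ≡⟨ sum-cong-≗ (λ u → sum-cong-≗ (λ v → *-CS.x∙yz≈y∙xz (χ (mem u p)) (χ (mem v q)) (h u v))) ⟩
  sum (λ u → sum (λ v → χ (mem v q) * (χ (mem u p) * h u v)))
    ≡⟨ ∑-comm (λ u v → χ (mem v q) * (χ (mem u p) * h u v)) ⟩
  sum (λ v → sum (λ u → χ (mem v q) * (χ (mem u p) * h u v)))
    ≡⟨ sum-cong-≗ (λ v → *-distribˡ-sum (χ (mem v q)) (λ u → χ (mem u p) * h u v)) ⟨
  sum (λ v → χ (mem v q) * sum (λ u → χ (mem u p) * h u v))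
    ∎
  where open ≡-Reasoning

∑∈∩+∑∈─≡∑∈ : (p q : Subset n) (f : Fin n → ℕ) → ∑[ i ∈ p ∩ q ] f i + ∑[ i ∈ p ─ q ] f i ≡ ∑[ i ∈ p ] f i
∑∈∩+∑∈─≡∑∈ p q f =
  trans (sym (∑-distrib-+ (λ i → χ (mem i (p ∩ q)) * f i) (λ i → χ (mem i (p ─ q)) * f i)))
        (sum-cong-≗ pointwise)
  where
  split : ∀ a b x → χ (a ∧ b) * x + χ (a ∧ not b) * x ≡ χ a * x
  split true  true  x = +-identityʳ _
  split true  false x = refl
  split false b     x = refl
  pointwise : ∀ i → χ (mem i (p ∩ q)) * f i + χ (mem i (p ─ q)) * f i ≡ χ (mem i p) * f i
  pointwise i rewrite mem-∩ i p q | mem-─ i p q = split (mem i p) (mem i q) (f i)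

∑∈p+∑∈q─p≤∑ : (p q : Subset n) (f : Fin n → ℕ) → ∑[ i ∈ p ] f i + ∑[ i ∈ q ─ p ] f i ≤ sum f
∑∈p+∑∈q─p≤∑ p q f =
  ≤-trans (≤-reflexive (sym (∑-distrib-+ (λ i → χ (mem i p) * f i) (λ i → χ (mem i (q ─ p)) * f i))))
          (∑-mono-≤ pointwise)
  where
  disjoint : ∀ a b x → χ a * x + χ (b ∧ not a) * x ≤ x
  disjoint true  true  x = ≤-reflexive (trans (+-identityʳ _) (+-identityʳ x))
  disjoint true  false x = ≤-reflexive (trans (+-identityʳ _) (+-identityʳ x))
  disjoint false true  x = ≤-reflexive (+-identityʳ x)
  disjoint false false x = z≤n
  pointwise : ∀ i → χ (mem i p) * f i + χ (mem i (q ─ p)) * f i ≤ f i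
  pointwise i rewrite mem-─ i q p = disjoint (mem i p) (mem i q) (f i)

∣p∣≡∣p∩q∣+∣p─q∣ : (p q : Subset n) → ∣ p ∣ ≡ ∣ p ∩ q ∣ + ∣ p ─ q ∣
∣p∣≡∣p∩q∣+∣p─q∣ p q = begin
  ∣ p ∣                               ≡⟨ ∣p∣≡∑∈1 p ⟩
  ∑[ i ∈ p ] 1                        ≡⟨ ∑∈∩+∑∈─≡∑∈ p q (λ _ → 1) ⟨
  ∑[ i ∈ p ∩ q ] 1 + ∑[ i ∈ p ─ q ] 1 ≡⟨ cong₂ _+_ (∣p∣≡∑∈1 (p ∩ q)) (∣p∣≡∑∈1 (p ─ q)) ⟨
  ∣ p ∩ q ∣ + ∣ p ─ q ∣               ∎
  where open ≡-Reasoning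

∣p─q∣≡0⇒p⊆q : (p q : Subset n) → ∣ p ─ q ∣ ≡ 0 → p ⊆ q
∣p─q∣≡0⇒p⊆q (_ ∷ p)       (inside  ∷ q) _ here        = here
∣p─q∣≡0⇒p⊆q (_ ∷ p)       (inside  ∷ q) e (there x∈p) = there (∣p─q∣≡0⇒p⊆q p q e x∈p)
∣p─q∣≡0⇒p⊆q (outside ∷ p) (outside ∷ q) e (there x∈p) = there (∣p─q∣≡0⇒p⊆q p q e x∈p)

∣p─q∣≡∣q─p∣ : (p q : Subset n) → ∣ p ∣ ≡ ∣ q ∣ → ∣ p ─ q ∣ ≡ ∣ q ─ p ∣
∣p─q∣≡∣q─p∣ p q ∣p∣≡∣q∣ = +-cancelˡ-≡ ∣ p ∩ q ∣ _ _ (begin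
  ∣ p ∩ q ∣ + ∣ p ─ q ∣ ≡⟨ ∣p∣≡∣p∩q∣+∣p─q∣ p q ⟨
  ∣ p ∣                 ≡⟨ ∣p∣≡∣q∣ ⟩
  ∣ q ∣                 ≡⟨ ∣p∣≡∣p∩q∣+∣p─q∣ q p ⟩
  ∣ q ∩ p ∣ + ∣ q ─ p ∣ ≡⟨ cong (λ r → ∣ r ∣ + ∣ q ─ p ∣) (∩-comm q p) ⟩
  ∣ p ∩ q ∣ + ∣ q ─ p ∣ ∎)
  where open ≡-Reasoning

p≢q⇒∣q─p∣>0 : (p q : Subset n) → p ≢ q → ∣ p ∣ ≡ ∣ q ∣ → ∣ q ─ p ∣ > 0
p≢q⇒∣q─p∣>0 p q p≢q ∣p∣≡∣q∣ = n≢0⇒n>0 λ ∣q─p∣≡0 →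
  p≢q (⊆-antisym (∣p─q∣≡0⇒p⊆q p q (trans (∣p─q∣≡∣q─p∣ p q ∣p∣≡∣q∣) ∣q─p∣≡0))
                 (∣p─q∣≡0⇒p⊆q q p ∣q─p∣≡0))

∣p∣≤1+∣q─p∣*∣p∩q∣ : (p q : Subset n) → p ≢ q → ∣ p ∣ ≡ ∣ q ∣ → Nonempty (p ∩ q) →
                    ∣ p ∣ ≤ suc (∣ q ─ p ∣ * ∣ p ∩ q ∣)
∣p∣≤1+∣q─p∣*∣p∩q∣ p q p≢q ∣p∣≡∣q∣ (x , x∈p∩q) = begin
  ∣ p ∣                     ≡⟨ ∣p∣≡∣p∩q∣+∣p─q∣ p q ⟩
  ∣ p ∩ q ∣ + ∣ p ─ q ∣     ≡⟨ cong (∣ p ∩ q ∣ +_) (∣p─q∣≡∣q─p∣ p q ∣p∣≡∣q∣) ⟩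
  ∣ p ∩ q ∣ + ∣ q ─ p ∣     ≡⟨ +-comm ∣ p ∩ q ∣ ∣ q ─ p ∣ ⟩
  ∣ q ─ p ∣ + ∣ p ∩ q ∣     ≤⟨ m+n≤1+m*n (p≢q⇒∣q─p∣>0 p q p≢q ∣p∣≡∣q∣)
                                         (≤-trans (s≤s z≤n) (x∈p⇒∣p-x∣<∣p∣ x∈p∩q)) ⟩
  suc (∣ q ─ p ∣ * ∣ p ∩ q ∣) ∎
  where open ≤-Reasoning

length-filter-tabulate : {A : Set} (f : A → Bool) (d : ∀ x → Dec (T (f x))) (g : Fin n → A) →
                         length (filter d (List.tabulate g)) ≡ sum (λ i → χ (f (g i)))
length-filter-tabulate {n = zero}  f d g = refl
length-filter-tabulate {n = suc n} f d g with f (g fzero) | d (g fzero)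
... | true  | yes _ = cong suc (length-filter-tabulate f d (g ∘ fsuc))
... | true  | no ¬t = contradiction tt ¬t
... | false | no _  = length-filter-tabulate f d (g ∘ fsuc)

length-filter-concatMap-tabulate : {A B : Set} {P : B → Set} (d : Decidable P) (h : A → List B) (g : Fin n → A) →
  length (filter d (concatMap h (List.tabulate g))) ≡ sum (λ i → length (filter d (h (g i))))
length-filter-concatMap-tabulate {n = zero}  d h g = refl
length-filter-concatMap-tabulate {n = suc n} d h g = begin
  length (filter d (h (g fzero) ++ concatMap h (List.tabulate (g ∘ fsuc))))
    ≡⟨ cong length (filter-++ d (h (g fzero)) _) ⟩
  length (filter d (h (g fzero)) ++ filter d (concatMap h (List.tabulate (g ∘ fsuc))))
    ≡⟨ length-++ (filter d (h (g fzero))) ⟩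
  length (filter d (h (g fzero))) + length (filter d (concatMap h (List.tabulate (g ∘ fsuc))))
    ≡⟨ cong (length (filter d (h (g fzero))) +_) (length-filter-concatMap-tabulate d h (g ∘ fsuc)) ⟩
  sum (λ i → length (filter d (h (g i))))
    ∎
  where open ≡-Reasoning

length-filter-allPairs : (f : Fin n × Fin n → Bool) (d : ∀ p → Dec (T (f p))) →
  length (filter d (concatMap (λ u → List.map (u ,_) (List.allFin n)) (List.allFin n)))
    ≡ sum (λ u → sum (λ v → χ (f (u , v))))
length-filter-allPairs {n} f d =
  trans (length-filter-concatMap-tabulate d (λ u → List.map (u ,_) (List.allFin n)) id)
        (sum-cong-≗ λ u → trans (cong (length ∘ filter d) (map-tabulate id (u ,_)))
                                 (length-filter-tabulate f d (u ,_)))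

module _ {n : ℕ} (G : Graph n) where

  -- The filter test of missingPairs, so that missing C u v is 1 exactly when u ≢ v are
  -- non-adjacent vertices of C, and missingDeg C u is the number of non-neighbours of u in C.
  isMissing : Subset n → Fin n → Fin n → Bool
  isMissing C u v = ⌊ toℕ u <? toℕ v ⌋ ∧ mem u C ∧ mem v C ∧ not (adj G u v)

  missing : Subset n → Fin n → Fin n → ℕ
  missing C u v = χ (isMissing C u v) + χ (isMissing C v u)

  missingDeg : Subset n → Fin n → ℕ
  missingDeg C u = sum (missing C u)

  missingEdges≡∑∑ : (C : Subset n) → missingEdges G C ≡ sum (λ u → sum (λ v → χ (isMissing C u v)))
  missingEdges≡∑∑ C = length-filter-allPairs (λ (u , v) → isMissing C u v) _

  ∑missingDeg≡2*missingEdges : (C : Subset n) → sum (missingDeg C) ≡ missingEdges G C + missingEdges G C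
  ∑missingDeg≡2*missingEdges C = begin
    sum (λ u → sum (λ v → χ (isMissing C u v) + χ (isMissing C v u)))
      ≡⟨ sum-cong-≗ (λ u → ∑-distrib-+ (λ v → χ (isMissing C u v)) (λ v → χ (isMissing C v u))) ⟩
    sum (λ u → sum (λ v → χ (isMissing C u v)) + sum (λ v → χ (isMissing C v u)))
      ≡⟨ ∑-distrib-+ (λ u → sum (λ v → χ (isMissing C u v))) (λ u → sum (λ v → χ (isMissing C v u))) ⟩
    sum (λ u → sum (λ v → χ (isMissing C u v))) + sum (λ u → sum (λ v → χ (isMissing C v u)))
      ≡⟨ cong (sum (λ u → sum (λ v → χ (isMissing C u v))) +_) (∑-comm (λ u v → χ (isMissing C v u))) ⟩
    sum (λ u → sum (λ v → χ (isMissing C u v))) + sum (λ v → sum (λ u → χ (isMissing C v u)))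
      ≡⟨ cong₂ _+_ (missingEdges≡∑∑ C) (missingEdges≡∑∑ C) ⟨
    missingEdges G C + missingEdges G C
      ∎
    where open ≡-Reasoning

  isMissing-intro : (C : Subset n) {u v : Fin n} → toℕ u < toℕ v →
                    mem u C ≡ true → mem v C ≡ true → adj G u v ≡ false → isMissing C u v ≡ true
  isMissing-intro C {u} {v} u<v u∈C v∈C uv rewrite u∈C | v∈C | uv with toℕ u <? toℕ v
  ... | yes _   = refl
  ... | no  u≮v = contradiction u<v u≮v

  adjacent-or-missing : (C : Subset n) {u v : Fin n} → mem u C ≡ true → mem v C ≡ true → u ≢ v →
                        1 ≤ χ (adj G u v) + missing C u v
  adjacent-or-missing C {u} {v} u∈C v∈C u≢v with <-cmp (toℕ u) (toℕ v)
  ... | tri< u<v _ _ = ≤-trans (1≤χa+χb (adj G u v) (isMissing-intro C u<v u∈C v∈C))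
                               (+-monoʳ-≤ (χ (adj G u v)) (m≤m+n _ _))
  ... | tri≈ _ u≡v _ = contradiction (toℕ-injective u≡v) u≢v
  ... | tri> _ _ v<u = ≤-trans (1≤χa+χb (adj G u v) (isMissing-intro C v<u v∈C u∈C ∘ trans (symm G v u)))
                               (+-monoʳ-≤ (χ (adj G u v)) (m≤n+m _ _))

  deg≡∑adj : (u : Fin n) → deg G u ≡ sum (λ v → χ (adj G u v))
  deg≡∑adj u = trans (∣p∣≡∑χ (N G u)) (sum-cong-≗ (λ v → cong χ (lookup∘tabulate (adj G u) v)))

  ∣C∣≤neighbours+missingDeg+1 : (C : Subset n) {u : Fin n} → mem u C ≡ true →
                                ∣ C ∣ ≤ ∑[ v ∈ C ] χ (adj G u v) + missingDeg C u + 1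
  ∣C∣≤neighbours+missingDeg+1 C {u} u∈C = begin
    ∣ C ∣
      ≡⟨ ∣p∣≡∑∈1 C ⟩
    ∑[ v ∈ C ] 1
      ≤⟨ ∑∈-mono-≤ C covered ⟩
    ∑[ v ∈ C ] (χ (adj G u v) + missing C u v + χ (does (v ≟ u)))
      ≡⟨ ∑∈-distrib-+ C (λ v → χ (adj G u v) + missing C u v) (λ v → χ (does (v ≟ u))) ⟩
    ∑[ v ∈ C ] (χ (adj G u v) + missing C u v) + ∑[ v ∈ C ] χ (does (v ≟ u))
      ≡⟨ cong (_+ _) (∑∈-distrib-+ C (λ v → χ (adj G u v)) (missing C u)) ⟩
    ∑[ v ∈ C ] χ (adj G u v) + ∑[ v ∈ C ] missing C u v + ∑[ v ∈ C ] χ (does (v ≟ u))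
      ≤⟨ +-mono-≤ (+-monoʳ-≤ (∑[ v ∈ C ] χ (adj G u v)) (∑∈≤∑ C (missing C u)))
                  (≤-trans (∑∈≤∑ C (λ v → χ (does (v ≟ u)))) (≤-reflexive (∑-δ u))) ⟩
    ∑[ v ∈ C ] χ (adj G u v) + missingDeg C u + 1
      ∎
    where
    open ≤-Reasoning
    covered : ∀ v → mem v C ≡ true → 1 ≤ χ (adj G u v) + missing C u v + χ (does (v ≟ u))
    covered v v∈C with v ≟ u
    ... | yes _   = m≤n+m 1 _
    ... | no  v≢u = ≤-trans (adjacent-or-missing C u∈C v∈C (v≢u ∘ sym)) (m≤m+n _ _)

  neighbours-outside≤missingDeg : {r : ℕ} (C D : Subset n) {u : Fin n} →
    MaxDegreeAtMost G r → ∣ C ∣ ≡ suc r → mem u C ≡ true →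
    ∑[ y ∈ D ─ C ] χ (adj G u y) ≤ missingDeg C u
  neighbours-outside≤missingDeg {r} C D {u} maxDeg ∣C∣≡1+r u∈C =
    +-cancelˡ-≤ inC _ _ (+-cancelʳ-≤ 1 _ _ (begin
      inC + outC + 1           ≤⟨ +-monoˡ-≤ 1 (≤-trans (∑∈p+∑∈q─p≤∑ C D (χ ∘ adj G u)) deg≤r) ⟩
      r + 1                    ≡⟨ +-comm r 1 ⟩
      suc r                    ≡⟨ ∣C∣≡1+r ⟨
      ∣ C ∣                    ≤⟨ ∣C∣≤neighbours+missingDeg+1 C u∈C ⟩
      inC + missingDeg C u + 1 ∎))
    where
    open ≤-Reasoning
    inC = ∑[ v ∈ C ] χ (adj G u v)
    outC = ∑[ y ∈ D ─ C ] χ (adj G u y)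
    deg≤r : sum (λ v → χ (adj G u v)) ≤ r
    deg≤r = ≤-trans (≤-reflexive (sym (deg≡∑adj u))) (maxDeg u)

  ∣C∩D∣≤neighbours+missingDeg : (C D : Subset n) {y : Fin n} → mem y (D ─ C) ≡ true →
    ∣ C ∩ D ∣ ≤ ∑[ u ∈ C ∩ D ] χ (adj G u y) + missingDeg D y
  ∣C∩D∣≤neighbours+missingDeg C D {y} y∈D─C = begin
    ∣ C ∩ D ∣
      ≡⟨ ∣p∣≡∑∈1 (C ∩ D) ⟩
    ∑[ u ∈ C ∩ D ] 1
      ≤⟨ ∑∈-mono-≤ (C ∩ D) covered ⟩
    ∑[ u ∈ C ∩ D ] (χ (adj G u y) + missing D y u)
      ≡⟨ ∑∈-distrib-+ (C ∩ D) (λ u → χ (adj G u y)) (missing D y) ⟩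
    ∑[ u ∈ C ∩ D ] χ (adj G u y) + ∑[ u ∈ C ∩ D ] missing D y u
      ≤⟨ +-monoʳ-≤ _ (∑∈≤∑ (C ∩ D) (missing D y)) ⟩
    ∑[ u ∈ C ∩ D ] χ (adj G u y) + missingDeg D y
      ∎
    where
    open ≤-Reasoning
    covered : ∀ u → mem u (C ∩ D) ≡ true → 1 ≤ χ (adj G u y) + missing D y u
    covered u u∈C∩D with ∈∩⇒ u C D u∈C∩D | ∈─⇒ y D C y∈D─C
    ... | u∈C , u∈D | y∈D , y∉C = subst (λ b → 1 ≤ χ b + missing D y u) (symm G y u)
                                        (adjacent-or-missing D y∈D u∈D (mem-separates C y∉C u∈C))

  overlap-bound : {r : ℕ} (C D : Subset n) → MaxDegreeAtMost G r → ∣ C ∣ ≡ suc r →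
    ∣ D ─ C ∣ * ∣ C ∩ D ∣ + ∑[ w ∈ C ─ D ] missingDeg C w
      ≤ missingEdges G C + missingEdges G C + ∑[ y ∈ D ─ C ] missingDeg D y
  overlap-bound C D maxDeg ∣C∣≡1+r = begin
    ∣ D ─ C ∣ * ∣ C ∩ D ∣ + α
      ≡⟨ cong (_+ α) (∑∈-const (D ─ C) ∣ C ∩ D ∣) ⟨
    ∑[ y ∈ D ─ C ] ∣ C ∩ D ∣ + α
      ≤⟨ +-monoˡ-≤ α (∑∈-mono-≤ (D ─ C) (λ _ → ∣C∩D∣≤neighbours+missingDeg C D)) ⟩
    ∑[ y ∈ D ─ C ] (∑[ u ∈ C ∩ D ] χ (adj G u y) + missingDeg D y) + α
      ≡⟨ cong (_+ α) (∑∈-distrib-+ (D ─ C) (λ y → ∑[ u ∈ C ∩ D ] χ (adj G u y)) (missingDeg D)) ⟩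
    crossEdges + β + α
      ≡⟨ +-CS.xy∙z≈xz∙y crossEdges β α ⟩
    crossEdges + α + β
      ≤⟨ +-monoˡ-≤ β (+-monoˡ-≤ α crossEdges≤) ⟩
    ∑[ u ∈ C ∩ D ] missingDeg C u + α + β
      ≡⟨ cong (_+ β) (∑∈∩+∑∈─≡∑∈ C D (missingDeg C)) ⟩
    ∑[ u ∈ C ] missingDeg C u + β
      ≤⟨ +-monoˡ-≤ β (∑∈≤∑ C (missingDeg C)) ⟩
    sum (missingDeg C) + β
      ≡⟨ cong (_+ β) (∑missingDeg≡2*missingEdges C) ⟩
    missingEdges G C + missingEdges G C + β
      ∎
    where
    open ≤-Reasoning
    α = ∑[ w ∈ C ─ D ] missingDeg C w
    β = ∑[ y ∈ D ─ C ] missingDeg D y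
    crossEdges = ∑[ y ∈ D ─ C ] ∑[ u ∈ C ∩ D ] χ (adj G u y)
    crossEdges≤ : crossEdges ≤ ∑[ u ∈ C ∩ D ] missingDeg C u
    crossEdges≤ = begin
      crossEdges
        ≡⟨ ∑∈-comm (C ∩ D) (D ─ C) (λ u y → χ (adj G u y)) ⟨
      ∑[ u ∈ C ∩ D ] ∑[ y ∈ D ─ C ] χ (adj G u y)
        ≤⟨ ∑∈-mono-≤ (C ∩ D) (λ u u∈C∩D →
             neighbours-outside≤missingDeg C D maxDeg ∣C∣≡1+r (proj₁ (∈∩⇒ u C D u∈C∩D))) ⟩
      ∑[ u ∈ C ∩ D ] missingDeg C u
        ∎

lemma4p3 : (r n : ℕ) → 6 ≤ r → (G : Graph n) →
    MaxDegreeAtMost G r → CliqueNumberAtMost G r →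
    (C D : Subset n) → IsConfiguration G r C → IsConfiguration G r D →
    ¬ (C ≡ D) → Disjoint C D
lemma4p3 r n 6≤r G maxDeg _ C D (∣C∣≡1+r , C-missing) (∣D∣≡1+r , D-missing) C≢D C∩D≠∅ =
  contradiction (≤-trans 6≤r (≤-trans r≤a*s a*s≤4)) (from-no (6 ≤? 4))
  where
  s = ∣ C ∩ D ∣
  a = ∣ D ─ C ∣
  α = ∑[ w ∈ C ─ D ] missingDeg G C w
  β = ∑[ y ∈ D ─ C ] missingDeg G D y
  ∣C∣≡∣D∣ : ∣ C ∣ ≡ ∣ D ∣
  ∣C∣≡∣D∣ = trans ∣C∣≡1+r (sym ∣D∣≡1+r)
  r≤a*s : r ≤ a * s
  r≤a*s = ≤-pred (subst (_≤ suc (a * s)) ∣C∣≡1+r (∣p∣≤1+∣q─p∣*∣p∩q∣ C D C≢D ∣C∣≡∣D∣ C∩D≠∅))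
  a*s≤4 : a * s ≤ 4
  a*s≤4 = ≤-from-crossed
    (subst (λ m → a * s + α ≤ m + m + β) C-missing (overlap-bound G C D maxDeg ∣C∣≡1+r))
    (subst₂ (λ k m → k + β ≤ m + m + α)
            (cong₂ _*_ (∣p─q∣≡∣q─p∣ C D ∣C∣≡∣D∣) (cong ∣_∣ (∩-comm D C))) D-missing
            (overlap-bound G D C maxDeg ∣D∣≡1+r))
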